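{- Let $n\ge 1$ and let $p=p_0p_1\cdots p_n$ be a permutation of the set $\{0,1,\dots,n\}$ (written in one-line notation). For $i=1,\dots,n$ let $c_i=\#\{j: 0\le j<i \text{ and } j \text{ precedes } i \text{ in } p\}$, and let $c=(c_1,\dots,c_n)$. Let $c\setminus \mathrm{FP}(c)$ denote the sequence obtained from $(c_1,\dots,c_n)$ by deleting every entry $c_i$ with $c_i=i$ (keeping the remaining entries in their original order). Then $p$ avoids both patterns $4132$ and $4231$ if and only if the sequence $c\setminus \mathrm{FP}(c)$ is weakly increasing.
   Context: The sequence $c=(c_i)_{i=1}^n$ is called the truncated coinversion table of $p$; an index $i$ with $c_i=i$ is a fixed point of $c$, and $\mathrm{FP}(c)$ is the list of fixed points. A permutation $p$ contains a pattern $\sigma=\sigma_1\cdots\sigma_k$ (a permutation of $\{1,\dots,k\}$) if there are positions $t_1<\dots<t_k$ such that $p_{t_a}<p_{t_b}$ if and only if $\sigma_a<\sigma_b$ for all $a,b$; otherwise $p$ avoids $\sigma$. Example: for $p=2\,1\,0\,7\,9\,6\,10\,5\,3\,4\,8$ one has $c=0\,0\,3\,4\,3\,3\,3\,8\,4\,6$, $\mathrm{FP}(c)=(3,4,8)$ and $c\setminus\mathrm{FP}(c)=0\,0\,3\,3\,3\,4\,6$. -}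

module Defs where

open import Data.Nat using (ℕ; zero; suc; _≤_; _<_)
open import Data.Nat.Properties using (_≟_)
open import Data.Fin using (Fin; toℕ) renaming (_<_ to _<ᶠ_)
open import Data.Fin.Properties using () renaming (_<?_ to _<ᶠ?_)
open import Data.List using (List; []; _∷_; filter; map; length; allFin)
open import Data.List.Relation.Unary.Linked using (Linked)
open import Data.Product using (Σ; _×_; _,_)
open import Function.Bundles using (_↔_; Inverse)
open import Relation.Nullary using (¬_)
open import Relation.Nullary.Decidable using (¬?)
open import Data.Nat using (_<?_)

-- A permutation of {0,1,...,n}, one-line notation p_0 p_1 ... p_n:
-- Inverse.to p t = p_t (the value at position t), Inverse.from p v = position of v.
Perm : ℕ → Set
Perm n = Fin (suc n) ↔ Fin (suc n)

val : ∀ {n} → Perm n → Fin (suc n) → Fin (suc n)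
val p = Inverse.to p

pos : ∀ {n} → Perm n → Fin (suc n) → Fin (suc n)
pos p = Inverse.from p

Contains : ∀ {n k} → Perm n → (Fin k → ℕ) → Set
Contains {n} {k} p σ =
  Σ (Fin k → Fin (suc n)) λ t →
    (∀ a b → a <ᶠ b → t a <ᶠ t b) ×
    (∀ a b → (val p (t a) <ᶠ val p (t b) → σ a < σ b) ×
             (σ a < σ b → val p (t a) <ᶠ val p (t b)))

Avoids : ∀ {n k} → Perm n → (Fin k → ℕ) → Set
Avoids p σ = ¬ Contains p σ

pat4132 : Fin 4 → ℕ
pat4132 Fin.zero = 4
pat4132 (Fin.suc Fin.zero) = 1
pat4132 (Fin.suc (Fin.suc Fin.zero)) = 3
pat4132 (Fin.suc (Fin.suc (Fin.suc Fin.zero))) = 2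

pat4231 : Fin 4 → ℕ
pat4231 Fin.zero = 4
pat4231 (Fin.suc Fin.zero) = 2
pat4231 (Fin.suc (Fin.suc Fin.zero)) = 3
pat4231 (Fin.suc (Fin.suc (Fin.suc Fin.zero))) = 1

coinv : ∀ {n} → Perm n → Fin (suc n) → ℕ
coinv {n} p i =
  length (filter (λ j → pos p j <ᶠ? pos p i)
                 (filter (λ j → toℕ j <? toℕ i) (allFin (suc n))))

table : ∀ {n} → Perm n → List (ℕ × ℕ)
table {n} p = map (λ i → (suc (toℕ i) , coinv p (Fin.suc i))) (allFin n)

cMinusFP : ∀ {n} → Perm n → List ℕ
cMinusFP p =
  map Data.Product.proj₂
      (filter (λ e → ¬? (Data.Product.proj₂ e ≟ Data.Product.proj₁ e)) (table p))

WeaklyIncreasing : List ℕ → Set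
WeaklyIncreasing = Linked _≤_

module Submission where

-- For a permutation p of {0,…,n} write j ≺ i when the value j stands left of
-- the value i, so that c_i counts the values j < i with j ≺ i.  Hence c_i ≤ i,
-- and c_i = i fails exactly when some smaller value stands right of i.
--
-- Both patterns 4132 and 4231 are "4•3•": entries w ≺ x ≺ z ≺ y with
-- x, y < z < w (whether x < y or y < x decides which of the two it is).  The
-- theorem is the chain of equivalences
--   p avoids 4132 and 4231
--     ⇔ p has no 4•3• occurrence
--     ⇔ c_i ≤ c_k whenever i < k and neither i nor k is a fixed point of c
--     ⇔ c ∖ FP(c) is weakly increasing.  If i < k are not fixed and
-- k ≺ i, a value j < i with k ≺ j ≺ i together with a smaller value right of i
-- forms a 4•3•; without such j, every value counted by c_i is counted by c_k.
-- Conversely, from a 4•3• occurrence w x z y take the least value w' > z with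
-- w' ≺ x: everything counted by c_{w'} is counted by c_z, and x is counted by
-- c_z only, so c_{w'} < c_z although z < w' are both non-fixed.

open import Defs
open import Data.Nat using (ℕ; zero; suc; _≤_; _<_; z≤n; s≤s; _<?_)
open import Data.Nat.Properties using (≤-refl; ≤-trans; ≤-pred; <⇒≤; <⇒≱; <-irrefl; _≟_)
open import Data.Fin using (Fin; toℕ) renaming (_<_ to _<ᶠ_)
open import Data.Fin.Properties using (any?; toℕ<n; <⇒≢)
  renaming (_<?_ to _<ᶠ?_; <-cmp to <ᶠ-cmp; <-trans to <ᶠ-trans; <-irrefl to <ᶠ-irrefl; <-asym to <ᶠ-asym)
open import Data.List using ([]; _∷_; filter; map; length; allFin; tabulate; lookup)
open import Data.List.Properties using (filter-≐; filter-all; filter-none; filter-notAll; length-filter; length-map; map-tabulate)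
open import Data.List.Membership.Propositional using (_∈_)
open import Data.List.Membership.Propositional.Properties using (∈-filter⁺; ∈-allFin)
open import Data.List.Relation.Unary.All as All using (All; []; _∷_)
open import Data.List.Relation.Unary.All.Properties using (all-filter; tabulate⁻) renaming (filter⁻ to All-filter⁻)
import Data.List.Relation.Unary.Any as Any
open import Data.List.Relation.Unary.AllPairs using (AllPairs; []; _∷_)
open import Data.List.Relation.Unary.AllPairs.Properties using (map⁺; map⁻; filter⁺; tabulate⁺-<)
open import Data.List.Relation.Unary.Linked using (Linked; []; [-]; _∷_)
open import Data.List.Relation.Unary.Linked.Properties using (AllPairs⇒Linked; Linked⇒AllPairs)
open import Data.Product using (Σ; _×_; _,_; proj₁; proj₂)
open import Data.Sum using (_⊎_; inj₁; inj₂; [_,_])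
open import Data.Empty using (⊥-elim)
open import Function using (_∘_; _on_)
open import Function.Bundles using (_⇔_; mk⇔; Inverse; Equivalence)
open import Function.Properties.Equivalence using (⇔-setoid)
open import Level using (0ℓ)
open import Relation.Binary using (Transitive; Tri; tri<; tri≈; tri>)
open import Relation.Binary.PropositionalEquality using (_≡_; _≢_; refl; sym; trans; cong; subst; subst₂; module ≡-Reasoning)
import Relation.Binary.Reasoning.Setoid as SetoidReasoning
open import Relation.Nullary using (¬_; Dec; yes; no; contradiction)
open import Relation.Nullary.Decidable using (_×-dec_; ¬?; from-yes)
open import Relation.Unary using (Decidable; _⊆_)

pattern 0F = Fin.zero
pattern 1F = Fin.suc 0F
pattern 2F = Fin.suc 1F
pattern 3F = Fin.suc 2F

module ⇔-Reasoning = SetoidReasoning (⇔-setoid 0ℓ)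

module _ {A : Set} {P Q : A → Set} (P? : Decidable P) (Q? : Decidable Q) where

  filter-filter : ∀ xs → filter P? (filter Q? xs) ≡ filter (λ x → P? x ×-dec Q? x) xs
  filter-filter [] = refl
  filter-filter (x ∷ xs) with Q? x
  ... | no _ with P? x
  ...   | yes _ = filter-filter xs
  ...   | no _  = filter-filter xs
  filter-filter (x ∷ xs) | yes _ with P? x
  ...   | yes _ = cong (x ∷_) (filter-filter xs)
  ...   | no _  = filter-filter xs

  filter-⊆ : P ⊆ Q → ∀ xs → filter P? xs ≡ filter P? (filter Q? xs)
  filter-⊆ P⊆Q xs =
    trans (filter-≐ P? (λ x → P? x ×-dec Q? x) ((λ px → px , P⊆Q px) , proj₁) xs)
          (sym (filter-filter xs))

  count-mono : P ⊆ Q → ∀ xs → length (filter P? xs) ≤ length (filter Q? xs)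
  count-mono P⊆Q xs rewrite filter-⊆ P⊆Q xs = length-filter P? (filter Q? xs)

  count-mono-strict : P ⊆ Q → ∀ {y} xs → y ∈ xs → Q y → ¬ P y →
                      length (filter P? xs) < length (filter Q? xs)
  count-mono-strict P⊆Q xs y∈xs qy ¬py rewrite filter-⊆ P⊆Q xs =
    filter-notAll P? (filter Q? xs) (Any.map (λ { refl → ¬py }) (∈-filter⁺ Q? y∈xs qy))

filter-map : ∀ {A B : Set} {P : B → Set} (P? : Decidable P) (f : A → B) xs →
             filter P? (map f xs) ≡ map f (filter (P? ∘ f) xs)
filter-map P? f [] = refl
filter-map P? f (x ∷ xs) with P? (f x)
... | yes _ = cong (f x ∷_) (filter-map P? f xs)
... | no _  = filter-map P? f xs

module _ {A : Set} {R : A → A → Set} where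

  AllPairs-tabulate⇔ : ∀ {m} {f : Fin m → A} →
                       AllPairs R (tabulate f) ⇔ (∀ {i j} → i <ᶠ j → R (f i) (f j))
  AllPairs-tabulate⇔ = mk⇔ pairs tabulate⁺-<
    where
    pairs : ∀ {m} {f : Fin m → A} → AllPairs R (tabulate f) → ∀ {i j} → i <ᶠ j → R (f i) (f j)
    pairs (h ∷ _) {0F}     {Fin.suc j} _         = tabulate⁻ h j
    pairs (_ ∷ t) {Fin.suc i} {Fin.suc j} (s≤s i<j) = pairs t i<j

  chain⇒ordered : Transitive R → ∀ {m} (f : Fin m → A) → Linked R (tabulate f) →
                  ∀ {i j} → i <ᶠ j → R (f i) (f j)
  chain⇒ordered R-trans f chain = Equivalence.to AllPairs-tabulate⇔ (Linked⇒AllPairs R-trans chain)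

  AllPairs-filter⇔ : ∀ {Q : A → Set} (Q? : Decidable Q) xs →
    AllPairs R (filter Q? xs) ⇔ AllPairs (λ x y → Q x → Q y → R x y) xs
  AllPairs-filter⇔ {Q} Q? xs = mk⇔ (widen xs) (λ ps → discharge (all-filter Q? xs) (filter⁺ Q? ps))
    where
    widen-All : ∀ {T : A → Set} ys → All T (filter Q? ys) → All (λ y → Q y → T y) ys
    widen-All ys ts = All-filter⁻ Q? (All.map (λ t _ → t) ts)
                        (All.map (λ ¬q q → contradiction q ¬q) (all-filter (¬? ∘ Q?) ys))
    widen : ∀ ys → AllPairs R (filter Q? ys) → AllPairs (λ x y → Q x → Q y → R x y) ys
    widen [] _ = []
    widen (y ∷ ys) ps with Q? y
    widen (y ∷ ys) (h ∷ t) | yes _  = All.map (λ r _ → r) (widen-All ys h) ∷ widen ys t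
    widen (y ∷ ys) ps      | no ¬qy = All.universal (λ _ qy → contradiction qy ¬qy) ys ∷ widen ys ps
    discharge : ∀ {ys} → All Q ys → AllPairs (λ x y → Q x → Q y → R x y) ys → AllPairs R ys
    discharge [] [] = []
    discharge (qy ∷ qs) (h ∷ t) = All.zipWith (λ (r , q) → r qy q) (h , qs) ∷ discharge qs t

strictMono-<⇔ : ∀ {k m} {u : Fin k → Fin m} → (∀ {r s} → r <ᶠ s → u r <ᶠ u s) →
                ∀ {r s} → u r <ᶠ u s ⇔ r <ᶠ s
strictMono-<⇔ {u = u} u-mono {r} {s} = mk⇔ reflect u-mono
  where
  reflect : u r <ᶠ u s → r <ᶠ s
  reflect ur<us with <ᶠ-cmp r s
  ... | tri< r<s _ _ = r<s
  ... | tri≈ _ refl _ = contradiction refl (<⇒≢ ur<us)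
  ... | tri> _ _ s<r = contradiction (u-mono s<r) (<ᶠ-asym ur<us)

least : ∀ {m} {P : Fin m → Set} → Decidable P → ∀ {x} → P x →
        Σ (Fin m) λ y → P y × (∀ {z} → P z → ¬ z <ᶠ y)
least {m} {P} P? {x} px = search (suc (toℕ x)) ≤-refl px
  where
  search : ∀ b {x} → toℕ x < b → P x → Σ (Fin m) λ y → P y × (∀ {z} → P z → ¬ z <ᶠ y)
  search (suc b) {x} x<b px with any? (λ z → P? z ×-dec z <ᶠ? x)
  ... | yes (z , pz , z<x) = search b (≤-trans z<x (≤-pred x<b)) pz
  ... | no none = x , px , λ pz z<x → none (_ , pz , z<x)

count-below : ∀ N m → m ≤ N → length (filter (λ j → toℕ j <? m) (allFin N)) ≡ m
count-below N zero _ =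
  cong length (filter-none (λ j → toℕ j <? 0) (All.universal (λ _ ()) (allFin N)))
count-below (suc N) (suc m) (s≤s m≤N) = cong suc (begin
  length (filter below (tabulate Fin.suc))
    ≡⟨ cong (length ∘ filter below) (sym (map-tabulate (λ j → j) Fin.suc)) ⟩
  length (filter below (map Fin.suc (allFin N)))
    ≡⟨ cong length (filter-map below Fin.suc (allFin N)) ⟩
  length (map Fin.suc (filter (below ∘ Fin.suc) (allFin N)))
    ≡⟨ length-map Fin.suc (filter (below ∘ Fin.suc) (allFin N)) ⟩
  length (filter (below ∘ Fin.suc) (allFin N))
    ≡⟨ cong length (filter-≐ (below ∘ Fin.suc) (λ j → toℕ j <? m) ((λ { (s≤s j<m) → j<m }) , s≤s) (allFin N)) ⟩
  length (filter (λ j → toℕ j <? m) (allFin N))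
    ≡⟨ count-below N m m≤N ⟩
  m ∎)
  where
  open ≡-Reasoning
  below : (j : Fin (suc N)) → Dec (toℕ j < suc m)
  below j = toℕ j <? suc m

module Coinversions {n : ℕ} (p : Perm n) where

  F : Set
  F = Fin (suc n)

  c : F → ℕ
  c = coinv p

  _≺_ : F → F → Set
  j ≺ i = pos p j <ᶠ pos p i

  _≺?_ : ∀ j i → Dec (j ≺ i)
  j ≺? i = pos p j <ᶠ? pos p i

  ≺-trans : ∀ {i j k} → i ≺ j → j ≺ k → i ≺ k
  ≺-trans = <ᶠ-trans

  ≺-irrefl : ∀ {i} → ¬ i ≺ i
  ≺-irrefl = <ᶠ-irrefl refl

  ≺-connex : ∀ {i j} → i ≢ j → i ≺ j ⊎ j ≺ i
  ≺-connex {i} {j} i≢j with <ᶠ-cmp (pos p i) (pos p j)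
  ... | tri< i≺j _ _ = inj₁ i≺j
  ... | tri> _ _ j≺i = inj₂ j≺i
  ... | tri≈ _ same _ = contradiction (begin
        i                   ≡⟨ sym (Inverse.strictlyInverseˡ p i) ⟩
        val p (pos p i)     ≡⟨ cong (val p) same ⟩
        val p (pos p j)     ≡⟨ Inverse.strictlyInverseˡ p j ⟩
        j                   ∎) i≢j
    where open ≡-Reasoning

  Counted : F → F → Set
  Counted i j = j ≺ i × j <ᶠ i

  Counted? : ∀ i → Decidable (Counted i)
  Counted? i j = (j ≺? i) ×-dec (toℕ j <? toℕ i)

  coinv-count : ∀ i → c i ≡ length (filter (Counted? i) (allFin (suc n)))
  coinv-count i = cong length (filter-filter (_≺? i) (λ j → toℕ j <? toℕ i) (allFin (suc n)))

  coinv-mono : ∀ {i k} → Counted i ⊆ Counted k → c i ≤ c k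
  coinv-mono {i} {k} i⊆k rewrite coinv-count i | coinv-count k =
    count-mono (Counted? i) (Counted? k) i⊆k (allFin (suc n))

  coinv-mono-strict : ∀ {i k y} → Counted i ⊆ Counted k → Counted k y → ¬ Counted i y → c i < c k
  coinv-mono-strict {i} {k} {y} i⊆k ky ¬iy rewrite coinv-count i | coinv-count k =
    count-mono-strict (Counted? i) (Counted? k) i⊆k (allFin (suc n)) (∈-allFin y) ky ¬iy

  NonFixed : F → Set
  NonFixed i = c i ≢ toℕ i

  values-below : ∀ i → length (filter (λ j → toℕ j <? toℕ i) (allFin (suc n))) ≡ toℕ i
  values-below i = count-below (suc n) (toℕ i) (<⇒≤ (toℕ<n i))

  fixed-if-smaller-precede : ∀ {i} → (∀ {j} → j <ᶠ i → j ≺ i) → c i ≡ toℕ i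
  fixed-if-smaller-precede {i} smaller-precede = trans
    (cong length (filter-all (_≺? i) (All.map smaller-precede (all-filter (λ j → toℕ j <? toℕ i) (allFin (suc n))))))
    (values-below i)

  nonFixed-if-smaller-follows : ∀ {i j} → j <ᶠ i → i ≺ j → NonFixed i
  nonFixed-if-smaller-follows {i} {j} j<i i≺j fixed = <-irrefl fixed c[i]<i
    where
    -- the smaller value j is not counted by c_i
    c[i]<i : c i < toℕ i
    c[i]<i = subst (c i <_) (values-below i)
      (filter-notAll (_≺? i) (filter (λ j → toℕ j <? toℕ i) (allFin (suc n)))
        (Any.map (λ { refl j≺i → <ᶠ-asym j≺i i≺j }) (∈-filter⁺ (λ j → toℕ j <? toℕ i) (∈-allFin j) j<i)))

  smaller-follows-if-nonFixed : ∀ {i} → NonFixed i → Σ F λ j → j <ᶠ i × i ≺ j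
  smaller-follows-if-nonFixed {i} nonFixed with any? (λ j → (toℕ j <? toℕ i) ×-dec (i ≺? j))
  ... | yes found = found
  ... | no none = contradiction (fixed-if-smaller-precede smaller-precede) nonFixed
    where
    smaller-precede : ∀ {j} → j <ᶠ i → j ≺ i
    smaller-precede {j} j<i with ≺-connex (<⇒≢ j<i)
    ... | inj₁ j≺i = j≺i
    ... | inj₂ i≺j = contradiction (j , j<i , i≺j) none

  zero-fixed : c 0F ≡ 0
  zero-fixed = fixed-if-smaller-precede (λ ())

  SortedOnNonFixed : Set
  SortedOnNonFixed = ∀ {i k} → i <ᶠ k → NonFixed i → NonFixed k → c i ≤ c k

  record Occurrence : Set where
    field
      w x z y     : F
      w≺x         : w ≺ x
      x≺z         : x ≺ z
      z≺y         : z ≺ y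
      x<z         : x <ᶠ z
      y<z         : y <ᶠ z
      z<w         : z <ᶠ w

  sorted⇒no-occurrence : SortedOnNonFixed → ¬ Occurrence
  sorted⇒no-occurrence sorted occ =
    <⇒≱ c[w′]<c[z] (sorted z<w′ z-nonFixed w′-nonFixed)
    where
    open Occurrence occ
    Above : F → Set
    Above v = z <ᶠ v × v ≺ x
    Above? : Decidable Above
    Above? v = (toℕ z <? toℕ v) ×-dec (v ≺? x)
    minimal : Σ F λ v → Above v × (∀ {u} → Above u → ¬ u <ᶠ v)
    minimal = least Above? (z<w , w≺x)
    w′ : F
    w′ = proj₁ minimal
    z<w′ : z <ᶠ w′
    z<w′ = proj₁ (proj₁ (proj₂ minimal))
    w′≺x : w′ ≺ x
    w′≺x = proj₂ (proj₁ (proj₂ minimal))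
    w′-least : ∀ {v} → Above v → ¬ v <ᶠ w′
    w′-least = proj₂ (proj₂ minimal)

    z-nonFixed : NonFixed z
    z-nonFixed = nonFixed-if-smaller-follows y<z z≺y
    w′-nonFixed : NonFixed w′
    w′-nonFixed = nonFixed-if-smaller-follows (<ᶠ-trans y<z z<w′) (≺-trans w′≺x (≺-trans x≺z z≺y))

    -- a value counted by c_{w′} stands left of x, so by minimality it lies below z
    w′⊆z : Counted w′ ⊆ Counted z
    w′⊆z {j} (j≺w′ , j<w′) with <ᶠ-cmp j z
    ... | tri< j<z _ _ = ≺-trans j≺w′ (≺-trans w′≺x x≺z) , j<z
    ... | tri≈ _ refl _ = contradiction (≺-trans j≺w′ (≺-trans w′≺x x≺z)) ≺-irrefl
    ... | tri> _ _ z<j = contradiction j<w′ (w′-least (z<j , ≺-trans j≺w′ w′≺x))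

    c[w′]<c[z] : c w′ < c z
    c[w′]<c[z] = coinv-mono-strict w′⊆z (x≺z , x<z) (λ (x≺w′ , _) → <ᶠ-asym x≺w′ w′≺x)

  no-occurrence⇒sorted : ¬ Occurrence → SortedOnNonFixed
  no-occurrence⇒sorted none {i} {k} i<k i-nonFixed _ with ≺-connex (<⇒≢ i<k)
  ... | inj₁ i≺k = coinv-mono (λ (j≺i , j<i) → ≺-trans j≺i i≺k , <ᶠ-trans j<i i<k)
  ... | inj₂ k≺i with any? (λ j → (toℕ j <? toℕ i) ×-dec ((k ≺? j) ×-dec (j ≺? i)))
  ...   | no nothing-between = coinv-mono i⊆k
    where
    -- a value counted by c_i does not stand between k and i, hence left of k
    i⊆k : Counted i ⊆ Counted k
    i⊆k {j} (j≺i , j<i) with ≺-connex (<⇒≢ (<ᶠ-trans j<i i<k))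
    ... | inj₁ j≺k = j≺k , <ᶠ-trans j<i i<k
    ... | inj₂ k≺j = contradiction (j , j<i , k≺j , j≺i) nothing-between
  ...   | yes (j , j<i , k≺j , j≺i) with smaller-follows-if-nonFixed i-nonFixed
  ...     | (j′ , j′<i , i≺j′) = ⊥-elim (none (record
            { w = k ; x = j ; z = i ; y = j′
            ; w≺x = k≺j ; x≺z = j≺i ; z≺y = i≺j′
            ; x<z = j<i ; y<z = j′<i ; z<w = i<k }))

  contains-by-ranks : ∀ {k} (σ : Fin k → ℕ) (ρ : Fin k → Fin k) → (∀ a → σ a ≡ suc (toℕ (ρ a))) →
    (u : Fin k → F) → (∀ {r s} → r <ᶠ s → u r <ᶠ u s) →
    (∀ {a b} → a <ᶠ b → u (ρ a) ≺ u (ρ b)) → Contains p σ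
  contains-by-ranks σ ρ σ≡1+ρ u u-mono in-order =
    (λ a → pos p (u (ρ a))) , (λ _ _ → in-order) , λ a b →
      Equivalence.to (values⇔pattern a b) , Equivalence.from (values⇔pattern a b)
    where
    open ⇔-Reasoning
    values⇔pattern : ∀ a b → val p (pos p (u (ρ a))) <ᶠ val p (pos p (u (ρ b))) ⇔ σ a < σ b
    values⇔pattern a b = begin
      val p (pos p (u (ρ a))) <ᶠ val p (pos p (u (ρ b)))
        ≈⟨ mk⇔ (subst₂ _<ᶠ_ (val∘pos (u (ρ a))) (val∘pos (u (ρ b))))
               (subst₂ _<ᶠ_ (sym (val∘pos (u (ρ a)))) (sym (val∘pos (u (ρ b))))) ⟩
      u (ρ a) <ᶠ u (ρ b)  ≈⟨ strictMono-<⇔ u-mono ⟩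
      ρ a <ᶠ ρ b          ≈⟨ mk⇔ s≤s ≤-pred ⟩
      suc (toℕ (ρ a)) < suc (toℕ (ρ b))
        ≈⟨ mk⇔ (subst₂ _<_ (sym (σ≡1+ρ a)) (sym (σ≡1+ρ b))) (subst₂ _<_ (σ≡1+ρ a) (σ≡1+ρ b)) ⟩
      σ a < σ b           ∎
      where
      val∘pos : ∀ v → val p (pos p v) ≡ v
      val∘pos = Inverse.strictlyInverseˡ p

  occurrence⇒contains : Occurrence → Contains p pat4132 ⊎ Contains p pat4231
  occurrence⇒contains occ = by-comparing (<ᶠ-cmp x y)
    where
    open Occurrence occ
    left-to-right : ∀ (v : Fin 4 → F) → v 0F ≡ w → v 1F ≡ x → v 2F ≡ z → v 3F ≡ y →
                    ∀ {a b} → a <ᶠ b → v a ≺ v b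
    left-to-right v refl refl refl refl = chain⇒ordered {R = _≺_} ≺-trans v (w≺x ∷ x≺z ∷ z≺y ∷ [-])
    by-comparing : Tri (x <ᶠ y) (x ≡ y) (y <ᶠ x) → Contains p pat4132 ⊎ Contains p pat4231
    by-comparing (tri< x<y _ _) = inj₁ (contains-by-ranks pat4132 ρ (λ { 0F → refl ; 1F → refl ; 2F → refl ; 3F → refl })
        u (chain⇒ordered {R = _<ᶠ_} <ᶠ-trans u (x<y ∷ y<z ∷ z<w ∷ [-])) (left-to-right (u ∘ ρ) refl refl refl refl))
      where
      u : Fin 4 → F
      u = lookup (x ∷ y ∷ z ∷ w ∷ [])
      ρ : Fin 4 → Fin 4
      ρ = lookup (3F ∷ 0F ∷ 2F ∷ 1F ∷ [])
    by-comparing (tri> _ _ y<x) = inj₂ (contains-by-ranks pat4231 ρ (λ { 0F → refl ; 1F → refl ; 2F → refl ; 3F → refl })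
        u (chain⇒ordered {R = _<ᶠ_} <ᶠ-trans u (y<x ∷ x<z ∷ z<w ∷ [-])) (left-to-right (u ∘ ρ) refl refl refl refl))
      where
      u : Fin 4 → F
      u = lookup (y ∷ x ∷ z ∷ w ∷ [])
      ρ : Fin 4 → Fin 4
      ρ = lookup (3F ∷ 1F ∷ 2F ∷ 0F ∷ [])
    by-comparing (tri≈ _ refl _) = contradiction (≺-trans x≺z z≺y) ≺-irrefl

  contains⇒occurrence : ∀ (σ : Fin 4 → ℕ) → σ 1F < σ 2F → σ 3F < σ 2F → σ 2F < σ 0F →
                        Contains p σ → Occurrence
  contains⇒occurrence σ σ₁<σ₂ σ₃<σ₂ σ₂<σ₀ (t , t-increasing , t-pattern) = record
    { w = v 0F ; x = v 1F ; z = v 2F ; y = v 3F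
    ; w≺x = left-to-right (s≤s z≤n) ; x≺z = left-to-right (s≤s (s≤s z≤n)) ; z≺y = left-to-right (s≤s (s≤s (s≤s z≤n)))
    ; x<z = value< σ₁<σ₂ ; y<z = value< σ₃<σ₂ ; z<w = value< σ₂<σ₀ }
    where
    v : Fin 4 → F
    v a = val p (t a)
    value< : ∀ {a b} → σ a < σ b → v a <ᶠ v b
    value< {a} {b} = proj₂ (t-pattern a b)
    left-to-right : ∀ {a b} → a <ᶠ b → v a ≺ v b
    left-to-right {a} {b} a<b = subst₂ _<ᶠ_ (sym (Inverse.strictlyInverseʳ p (t a)))
                                           (sym (Inverse.strictlyInverseʳ p (t b))) (t-increasing a b a<b)

  avoids⇔no-occurrence : (Avoids p pat4132 × Avoids p pat4231) ⇔ (¬ Occurrence)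
  avoids⇔no-occurrence = mk⇔
    (λ (avoids₁ , avoids₂) occ → [ avoids₁ , avoids₂ ] (occurrence⇒contains occ))
    (λ none → none ∘ contains⇒occurrence pat4132 (from-yes (1 <? 3)) (from-yes (2 <? 3)) (from-yes (3 <? 4))
            , none ∘ contains⇒occurrence pat4231 (from-yes (2 <? 3)) (from-yes (1 <? 3)) (from-yes (3 <? 4)))

  cMinusFP⇔sorted : WeaklyIncreasing (cMinusFP p) ⇔ SortedOnNonFixed
  cMinusFP⇔sorted = begin
    WeaklyIncreasing (cMinusFP p)
      ≈⟨ mk⇔ (Linked⇒AllPairs ≤-trans) AllPairs⇒Linked ⟩
    AllPairs _≤_ (map proj₂ (filter NotFixed? (map entry (allFin n))))
      ≈⟨ mk⇔ map⁻ map⁺ ⟩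
    AllPairs (_≤_ on proj₂) (filter NotFixed? (map entry (allFin n)))
      ≈⟨ AllPairs-filter⇔ NotFixed? (map entry (allFin n)) ⟩
    AllPairs (λ e e′ → NotFixedEntry e → NotFixedEntry e′ → proj₂ e ≤ proj₂ e′) (map entry (allFin n))
      ≈⟨ mk⇔ map⁻ map⁺ ⟩
    AllPairs (λ i k → NonFixed (Fin.suc i) → NonFixed (Fin.suc k) → c (Fin.suc i) ≤ c (Fin.suc k)) (tabulate (λ i → i))
      ≈⟨ AllPairs-tabulate⇔ ⟩
    (∀ {i k} → i <ᶠ k → NonFixed (Fin.suc i) → NonFixed (Fin.suc k) → c (Fin.suc i) ≤ c (Fin.suc k))
      ≈⟨ mk⇔ include-zero (λ sorted i<k → sorted (s≤s i<k)) ⟩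
    SortedOnNonFixed ∎
    where
    open ⇔-Reasoning
    entry : Fin n → ℕ × ℕ
    entry i = suc (toℕ i) , c (Fin.suc i)
    NotFixedEntry : ℕ × ℕ → Set
    NotFixedEntry e = ¬ (proj₂ e ≡ proj₁ e)
    NotFixed? : Decidable NotFixedEntry
    NotFixed? e = ¬? (proj₂ e ≟ proj₁ e)
    -- the value 0 is always a fixed point, so only the values 1,…,n matter
    include-zero : (∀ {i k} → i <ᶠ k → NonFixed (Fin.suc i) → NonFixed (Fin.suc k) → c (Fin.suc i) ≤ c (Fin.suc k)) →
                   SortedOnNonFixed
    include-zero sorted₊ {0F} _ nonFixed₀ _ = contradiction zero-fixed nonFixed₀
    include-zero sorted₊ {Fin.suc i} {Fin.suc k} (s≤s i<k) = sorted₊ i<k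

mainTheorem1 : (n : ℕ) → 1 Data.Nat.≤ n → (p : Perm n) →
    (Avoids p pat4132 × Avoids p pat4231) ⇔ WeaklyIncreasing (cMinusFP p)
mainTheorem1 n _ p = begin
  (Avoids p pat4132 × Avoids p pat4231) ≈⟨ avoids⇔no-occurrence ⟩
  ¬ Occurrence                        ≈⟨ mk⇔ no-occurrence⇒sorted sorted⇒no-occurrence ⟩
  SortedOnNonFixed                    ≈˘⟨ cMinusFP⇔sorted ⟩
  WeaklyIncreasing (cMinusFP p)       ∎
  where
  open Coinversions p
  open ⇔-Reasoning
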